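{- For every integer $n\geq 3$, every strong tournament on $n$ vertices has at least $3$ minimal feedback vertex sets, and there exists a strong tournament on $n$ vertices with exactly $3$ minimal feedback vertex sets. In other words, $m^*(n)=3$ for all $n\geq 3$, where $m^*(n)$ denotes the minimum, over all strong tournaments $T$ on $n$ vertices, of the number $f(T)$ of minimal feedback vertex sets of $T$.
   Context: A tournament $T=(V,A)$ is a directed graph with exactly one arc between every pair of distinct vertices. $T$ is strong if there is a directed path between any two vertices. A feedback vertex set of $T$ is a set $F\subseteq V$ such that $T[V\setminus F]$ has no directed cycle; it is minimal if no proper subset of it is a feedback vertex set. $f(T)$ denotes the number of minimal feedback vertex sets of $T$. -}

module Defs where

open import Data.Nat using (ℕ)
open import Data.Fin using (Fin)
open import Data.Fin.Subset using (Subset; _∈_; _∉_; _⊂_)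
open import Data.Bool using (Bool; true; false)
open import Data.Sum using (_⊎_)
open import Data.Product using (_×_; ∃-syntax)
open import Relation.Binary.PropositionalEquality using (_≡_; _≢_)
open import Relation.Nullary using (¬_)

-- A tournament on vertex set Fin n: adj u v ≡ true means there is an arc u → v.
record Tournament (n : ℕ) : Set where
  field
    adj     : Fin n → Fin n → Bool
    irrefl  : ∀ u → adj u u ≡ false
    total   : ∀ u v → u ≢ v → adj u v ≡ true ⊎ adj v u ≡ true
    antisym : ∀ u v → adj u v ≡ true → adj v u ≡ false

open Tournament public

data Reach {n : ℕ} (T : Tournament n) : Fin n → Fin n → Set where
  here  : ∀ {u} → Reach T u u
  there : ∀ {u w v} → adj T u w ≡ true → Reach T w v → Reach T u v

Strong : ∀ {n} → Tournament n → Set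
Strong T = ∀ u v → Reach T u v

-- Nonempty directed walk from u to v using only vertices outside F,
-- i.e. a walk in the induced subtournament T[V \ F].
data WalkAvoid {n : ℕ} (T : Tournament n) (F : Subset n) : Fin n → Fin n → Set where
  arc  : ∀ {u v} → u ∉ F → v ∉ F → adj T u v ≡ true → WalkAvoid T F u v
  cons : ∀ {u w v} → u ∉ F → adj T u w ≡ true → WalkAvoid T F w v → WalkAvoid T F u v

-- F is a feedback vertex set: T[V \ F] has no directed cycle
-- (equivalently no nonempty closed walk).
FVS : ∀ {n} → Tournament n → Subset n → Set
FVS T F = ∀ v → ¬ WalkAvoid T F v v

MinFVS : ∀ {n} → Tournament n → Subset n → Set
MinFVS T F = FVS T F × (∀ G → G ⊂ F → ¬ FVS T G)

AtLeast3MinFVS : ∀ {n} → Tournament n → Set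
AtLeast3MinFVS T = ∃[ F₁ ] ∃[ F₂ ] ∃[ F₃ ]
  (MinFVS T F₁ × MinFVS T F₂ × MinFVS T F₃ × F₁ ≢ F₂ × F₁ ≢ F₃ × F₂ ≢ F₃)

Exactly3MinFVS : ∀ {n} → Tournament n → Set
Exactly3MinFVS T = ∃[ F₁ ] ∃[ F₂ ] ∃[ F₃ ]
  (MinFVS T F₁ × MinFVS T F₂ × MinFVS T F₃ × F₁ ≢ F₂ × F₁ ≢ F₃ × F₂ ≢ F₃
   × (∀ F → MinFVS T F → F ≡ F₁ ⊎ F ≡ F₂ ⊎ F ≡ F₃))

module Submission where

-- In a tournament every closed walk can be shortened to a directed triangle,
-- so F is a feedback vertex set exactly when it meets every triangle; this
-- makes "F is an FVS" decidable, and a descent on ∣F∣ shows that every FVS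
-- contains a minimal one.  Given a triangle a → b → c → a, all vertices but
-- a and b form an FVS (a triangle has three distinct vertices), so it
-- contains a minimal FVS, which must contain c but neither a nor b.  Rotating
-- the triangle gives three minimal FVSs separated by their traces on
-- {a, b, c}.  A strong tournament with two vertices contains a triangle.
--
-- On 0, …, L (L = n - 1) take the transitive
-- tournament i → j for i < j and reverse the single arc 0 → L.  Every
-- triangle is L → 0 → x → L with 0 < x < L, so the minimal FVSs are exactly
-- {0}, {L} and {1, …, L - 1}; the tournament is strong since every vertex
-- reaches L and L reaches every vertex.

open import Defs
open import Data.Nat using (ℕ; _≤_; zero; suc; z≤n; s≤s; _<_)
open import Data.Nat.Induction using (<-wellFounded)
import Data.Nat.Properties as ℕ
open import Data.Fin as Fin using (Fin; toℕ; fromℕ)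
open import Data.Fin.Properties using (any?; toℕ-injective; toℕ-fromℕ; toℕ<n)
open import Data.Fin.Subset using (Subset; _∈_; _∉_; _⊆_; _⊂_; ⁅_⁆; _∪_; ∁; ∣_∣)
  renaming (⊥ to ∅)
open import Data.Fin.Subset.Properties
  using (_∈?_; _⊂?_; anySubset?; ⊆-antisym; ⊆-trans; p⊂q⇒∣p∣<∣q∣; p⊂q⇒p⊆q;
         x∈p∪q⁺; x∈p∪q⁻; x∈∁p⇒x∉p; x∉∁p⇒x∈p; x∈⁅x⁆; x∈⁅y⁆⇒x≡y; ∉⊥)
open import Data.Bool using (true; false)
import Data.Bool as Bool
open import Data.Sum using (_⊎_; inj₁; inj₂)
import Data.Sum as Sum
open import Data.Product using (_×_; ∃-syntax; Σ; _,_; proj₁; proj₂)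
open import Data.Empty using (⊥-elim) renaming (⊥ to Empty)
open import Induction.WellFounded using (Acc; acc)
open import Relation.Nullary using (¬_; Dec; yes; no; does)
open import Relation.Nullary.Decidable using (_×-dec_; _⊎-dec_; ¬?; dec-true; dec-false)
open import Relation.Binary.PropositionalEquality
open import Relation.Binary.Definitions using (tri<; tri≈; tri>)

does-true : ∀ {P : Set} (d : Dec P) → does d ≡ true → P
does-true (yes p) _ = p
does-true (no _) ()

allBut : ∀ {n} → Fin n → Fin n → Subset n
allBut a b = ∁ (⁅ a ⁆ ∪ ⁅ b ⁆)

allBut-∌ˡ : ∀ {n} (a b : Fin n) → a ∉ allBut a b
allBut-∌ˡ a b p = x∈∁p⇒x∉p p (x∈p∪q⁺ (inj₁ (x∈⁅x⁆ a)))

allBut-∌ʳ : ∀ {n} (a b : Fin n) → b ∉ allBut a b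
allBut-∌ʳ a b p = x∈∁p⇒x∉p p (x∈p∪q⁺ (inj₂ (x∈⁅x⁆ b)))

∉allBut : ∀ {n} {a b x : Fin n} → x ∉ allBut a b → x ≡ a ⊎ x ≡ b
∉allBut {a = a} {b} x∉ =
  Sum.map (x∈⁅y⁆⇒x≡y a) (x∈⁅y⁆⇒x≡y b) (x∈p∪q⁻ ⁅ a ⁆ ⁅ b ⁆ (x∉∁p⇒x∈p x∉))

no-three-in-two : ∀ {n} {a b x y z : Fin n} → x ≢ y → y ≢ z → z ≢ x →
  x ≡ a ⊎ x ≡ b → y ≡ a ⊎ y ≡ b → z ≡ a ⊎ z ≡ b → Empty
no-three-in-two x≢y _ _ (inj₁ refl) (inj₁ refl) _ = x≢y refl
no-three-in-two x≢y _ _ (inj₂ refl) (inj₂ refl) _ = x≢y refl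
no-three-in-two _ _ z≢x (inj₁ refl) (inj₂ refl) (inj₁ refl) = z≢x refl
no-three-in-two _ y≢z _ (inj₁ refl) (inj₂ refl) (inj₂ refl) = y≢z refl
no-three-in-two _ y≢z _ (inj₂ refl) (inj₁ refl) (inj₁ refl) = y≢z refl
no-three-in-two _ _ z≢x (inj₂ refl) (inj₁ refl) (inj₂ refl) = z≢x refl

⊂⁅⁆⇒empty : ∀ {n} {G : Subset n} {x : Fin n} → G ⊂ ⁅ x ⁆ → ∀ y → y ∉ G
⊂⁅⁆⇒empty {x = x} (G⊆ , z , z∈ , z∉G) y y∈G =
  z∉G (subst (_∈ _) (trans (x∈⁅y⁆⇒x≡y x (G⊆ y∈G)) (sym (x∈⁅y⁆⇒x≡y x z∈))) y∈G)

module TournamentTheory {n : ℕ} (T : Tournament n) where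

  infix 4 _⟶_
  _⟶_ : Fin n → Fin n → Set
  u ⟶ v = adj T u v ≡ true

  ⟶-irreflexive : ∀ {u v} → u ⟶ v → u ≢ v
  ⟶-irreflexive {u} u⟶u refl with () ← trans (sym u⟶u) (irrefl T u)

  ⟶-asymmetric : ∀ {u v} → u ⟶ v → v ⟶ u → Empty
  ⟶-asymmetric {u} {v} u⟶v v⟶u with () ← trans (sym v⟶u) (antisym T u v u⟶v)

  Triangle : Subset n → Fin n → Fin n → Fin n → Set
  Triangle F a b c = a ∉ F × b ∉ F × c ∉ F × a ⟶ b × b ⟶ c × c ⟶ a

  AvoidedTriangle : Subset n → Set
  AvoidedTriangle F = ∃[ a ] ∃[ b ] ∃[ c ] Triangle F a b c

  rotate : ∀ {F a b c} → Triangle F a b c → Triangle F b c a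
  rotate (a∉ , b∉ , c∉ , ab , bc , ca) = b∉ , c∉ , a∉ , bc , ca , ab

  triangle⇒cycle : ∀ {F a b c} → Triangle F a b c → WalkAvoid T F a a
  triangle⇒cycle (a∉ , b∉ , c∉ , ab , bc , ca) = cons a∉ ab (cons b∉ bc (arc c∉ a∉ ca))

  walk-start∉ : ∀ {F u v} → WalkAvoid T F u v → u ∉ F
  walk-start∉ (arc u∉ _ _) = u∉
  walk-start∉ (cons u∉ _ _) = u∉

  -- Along the walk w → x → …, either x → v closes the
  -- triangle v w x, or v → x and we continue from x.
  close-triangle : ∀ {F v w} → v ∉ F → v ⟶ w → WalkAvoid T F w v → AvoidedTriangle F
  close-triangle _ v⟶w (arc _ _ w⟶v) = ⊥-elim (⟶-asymmetric v⟶w w⟶v)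
  close-triangle {F} {v} {w} v∉ v⟶w (cons {w = x} w∉ w⟶x walk) with v Fin.≟ x
  ... | yes refl = ⊥-elim (⟶-asymmetric v⟶w w⟶x)
  ... | no v≢x with adj T x v in x⟶v
  ...   | true = v , w , x , v∉ , w∉ , walk-start∉ walk , v⟶w , w⟶x , x⟶v
  ...   | false with total T v x v≢x
  ...     | inj₁ v⟶x = close-triangle v∉ v⟶x walk
  ...     | inj₂ x→v with () ← trans (sym x→v) x⟶v

  cycle⇒triangle : ∀ {F v} → WalkAvoid T F v v → AvoidedTriangle F
  cycle⇒triangle (arc _ _ v⟶v) = ⊥-elim (⟶-irreflexive v⟶v refl)
  cycle⇒triangle (cons v∉ v⟶w walk) = close-triangle v∉ v⟶w walk

  no-triangle⇒FVS : ∀ {F} → ¬ AvoidedTriangle F → FVS T F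
  no-triangle⇒FVS none v cycle = none (cycle⇒triangle cycle)

  FVS-meets-triangle : ∀ {F a b c} → FVS T F → a ⟶ b → b ⟶ c → c ⟶ a →
    a ∈ F ⊎ b ∈ F ⊎ c ∈ F
  FVS-meets-triangle {F} {a} {b} {c} fvs ab bc ca with a ∈? F | b ∈? F | c ∈? F
  ... | yes a∈ | _      | _      = inj₁ a∈
  ... | no _   | yes b∈ | _      = inj₂ (inj₁ b∈)
  ... | no _   | no _   | yes c∈ = inj₂ (inj₂ c∈)
  ... | no a∉  | no b∉  | no c∉  = ⊥-elim (fvs a (triangle⇒cycle (a∉ , b∉ , c∉ , ab , bc , ca)))

  triangle? : ∀ F a b c → Dec (Triangle F a b c)
  triangle? F a b c = ¬? (a ∈? F) ×-dec ¬? (b ∈? F) ×-dec ¬? (c ∈? F) ×-dec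
    (adj T a b Bool.≟ true) ×-dec (adj T b c Bool.≟ true) ×-dec (adj T c a Bool.≟ true)

  FVS? : ∀ F → Dec (FVS T F)
  FVS? F with any? (λ a → any? (λ b → any? (λ c → triangle? F a b c)))
  ... | yes (a , b , c , t) = no λ fvs → fvs a (triangle⇒cycle t)
  ... | no none = yes (no-triangle⇒FVS none)

  minimal-below : ∀ F → FVS T F → ∃[ G ] G ⊆ F × MinFVS T G
  minimal-below F = descend F (<-wellFounded ∣ F ∣)
    where
    descend : ∀ F → Acc _<_ ∣ F ∣ → FVS T F → ∃[ G ] G ⊆ F × MinFVS T G
    descend F (acc smaller) fvs with anySubset? (λ G → (G ⊂? F) ×-dec FVS? G)
    ... | no none = F , (λ x∈ → x∈) , fvs , λ G G⊂F fvsG → none (G , G⊂F , fvsG)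
    ... | yes (G , G⊂F , fvsG) with descend G (smaller (p⊂q⇒∣p∣<∣q∣ G⊂F)) fvsG
    ...   | H , H⊆G , minH = H , ⊆-trans H⊆G (p⊂q⇒p⊆q G⊂F) , minH

  minimal-⊇-FVS : ∀ {F H} → MinFVS T F → H ⊆ F → FVS T H → F ≡ H
  minimal-⊇-FVS {F} {H} (_ , minimal) H⊆F fvsH with any? (λ x → x ∈? F ×-dec ¬? (x ∈? H))
  ... | yes (x , x∈F , x∉H) = ⊥-elim (minimal H (H⊆F , x , x∈F , x∉H) fvsH)
  ... | no none = ⊆-antisym F⊆H H⊆F
    where
    F⊆H : F ⊆ H
    F⊆H {x} x∈F with x ∈? H
    ... | yes x∈H = x∈H
    ... | no x∉H = ⊥-elim (none (x , x∈F , x∉H))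

  -- Two vertices meet no triangle, so all other vertices form an FVS.
  allBut-FVS : ∀ a b → FVS T (allBut a b)
  allBut-FVS a b = no-triangle⇒FVS λ { (x , y , z , x∉ , y∉ , z∉ , xy , yz , zx) →
    no-three-in-two (⟶-irreflexive xy) (⟶-irreflexive yz) (⟶-irreflexive zx)
      (∉allBut x∉) (∉allBut y∉) (∉allBut z∉) }

  minimal-through : ∀ {a b c} → a ⟶ b → b ⟶ c → c ⟶ a →
    ∃[ F ] MinFVS T F × c ∈ F × a ∉ F × b ∉ F
  minimal-through {a} {b} {c} ab bc ca
    with minimal-below (allBut a b) (allBut-FVS a b)
  ... | F , F⊆ , minF = F , minF , c∈F , a∉F , b∉F
    where
    a∉F : a ∉ F
    a∉F a∈F = allBut-∌ˡ a b (F⊆ a∈F)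
    b∉F : b ∉ F
    b∉F b∈F = allBut-∌ʳ a b (F⊆ b∈F)
    c∈F : c ∈ F
    c∈F with FVS-meets-triangle (proj₁ minF) ab bc ca
    ... | inj₁ a∈F = ⊥-elim (a∉F a∈F)
    ... | inj₂ (inj₁ b∈F) = ⊥-elim (b∉F b∈F)
    ... | inj₂ (inj₂ c∈F) = c∈F

  triangle⇒three-minimal : ∀ {a b c} → a ⟶ b → b ⟶ c → c ⟶ a → AtLeast3MinFVS T
  triangle⇒three-minimal {a} {b} {c} ab bc ca
    with minimal-through ab bc ca | minimal-through bc ca ab | minimal-through ca ab bc
  ... | Fc , minFc , c∈Fc , _ , _ | Fa , minFa , a∈Fa , _ , c∉Fa | Fb , minFb , _ , c∉Fb , a∉Fb =
    Fc , Fa , Fb , minFc , minFa , minFb ,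
    (λ Fc≡Fa → c∉Fa (subst (c ∈_) Fc≡Fa c∈Fc)) ,
    (λ Fc≡Fb → c∉Fb (subst (c ∈_) Fc≡Fb c∈Fc)) ,
    (λ Fa≡Fb → a∉Fb (subst (a ∈_) Fa≡Fb a∈Fa))

  reach-trans : ∀ {u v w} → Reach T u v → Reach T v w → Reach T u w
  reach-trans here q = q
  reach-trans (there u⟶x p) q = there u⟶x (reach-trans p q)

  arc-and-path⇒cycle : ∀ {u w v} → u ⟶ w → Reach T w v → WalkAvoid T ∅ u v
  arc-and-path⇒cycle u⟶w here = arc ∉⊥ ∉⊥ u⟶w
  arc-and-path⇒cycle u⟶w (there w⟶x path) = cons ∉⊥ u⟶w (arc-and-path⇒cycle w⟶x path)

  -- In a strong tournament the arc between two distinct vertices lies on a cycle.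
  strong⇒triangle : Strong T → (u v : Fin n) → u ≢ v → AvoidedTriangle ∅
  strong⇒triangle strong u v u≢v with total T u v u≢v
  ... | inj₁ u⟶v = cycle⇒triangle (arc-and-path⇒cycle u⟶v (strong v u))
  ... | inj₂ v⟶u = cycle⇒triangle (arc-and-path⇒cycle v⟶u (strong u v))

  strong⇒three-minimal : Strong T → (u v : Fin n) → u ≢ v → AtLeast3MinFVS T
  strong⇒three-minimal strong u v u≢v with strong⇒triangle strong u v u≢v
  ... | _ , _ , _ , _ , _ , _ , ab , bc , ca = triangle⇒three-minimal ab bc ca

module Example (m : ℕ) where

  N L : ℕ
  N = suc (suc (suc m))
  L = suc (suc m)

  Reversed : Fin N → Fin N → Set
  Reversed u v = toℕ u ≡ L × toℕ v ≡ 0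

  Arc : Fin N → Fin N → Set
  Arc u v = Reversed u v ⊎ (toℕ u < toℕ v × ¬ Reversed v u)

  reversed? : ∀ u v → Dec (Reversed u v)
  reversed? u v = (toℕ u ℕ.≟ L) ×-dec (toℕ v ℕ.≟ 0)

  arc? : ∀ u v → Dec (Arc u v)
  arc? u v = reversed? u v ⊎-dec ((toℕ u ℕ.<? toℕ v) ×-dec ¬? (reversed? v u))

  L≢0 : ∀ {k} → k ≡ L → k ≡ 0 → Empty
  L≢0 refl ()

  Arc-irreflexive : ∀ u → ¬ Arc u u
  Arc-irreflexive u (inj₁ (≡L , ≡0)) = L≢0 ≡L ≡0
  Arc-irreflexive u (inj₂ (u<u , _)) = ℕ.<-irrefl refl u<u

  Arc-total : ∀ u v → u ≢ v → Arc u v ⊎ Arc v u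
  Arc-total u v u≢v with arc? u v
  ... | yes uv = inj₁ uv
  ... | no ¬uv with reversed? v u
  ...   | yes rev = inj₂ (inj₁ rev)
  ...   | no ¬rev with ℕ.<-cmp (toℕ u) (toℕ v)
  ...     | tri< u<v _ _ = ⊥-elim (¬uv (inj₂ (u<v , ¬rev)))
  ...     | tri≈ _ u≡v _ = ⊥-elim (u≢v (toℕ-injective u≡v))
  ...     | tri> _ _ v<u = inj₂ (inj₂ (v<u , λ rev → ¬uv (inj₁ rev)))

  Arc-asymmetric : ∀ u v → Arc u v → ¬ Arc v u
  Arc-asymmetric u v (inj₁ (≡L , _)) (inj₁ (_ , ≡0)) = L≢0 ≡L ≡0
  Arc-asymmetric u v (inj₁ rev) (inj₂ (_ , ¬rev)) = ¬rev rev
  Arc-asymmetric u v (inj₂ (_ , ¬rev)) (inj₁ rev) = ¬rev rev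
  Arc-asymmetric u v (inj₂ (u<v , _)) (inj₂ (v<u , _)) = ℕ.<-asym u<v v<u

  T : Tournament N
  T = record
    { adj = λ u v → does (arc? u v)
    ; irrefl = λ u → dec-false (arc? u u) (Arc-irreflexive u)
    ; total = λ u v u≢v → Sum.map (dec-true (arc? u v)) (dec-true (arc? v u)) (Arc-total u v u≢v)
    ; antisym = λ u v uv → dec-false (arc? v u) (Arc-asymmetric u v (does-true (arc? u v) uv))
    }

  open TournamentTheory T

  first last one : Fin N
  first = Fin.zero
  last = fromℕ L
  one = Fin.suc Fin.zero

  last≢first : last ≢ first
  last≢first e = L≢0 (toℕ-fromℕ L) (cong toℕ e)

  Interior : Fin N → Set
  Interior x = x ≢ first × x ≢ last

  one-interior : Interior one
  one-interior = (λ ()) , (λ ())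

  last⟶first : last ⟶ first
  last⟶first = dec-true (arc? last first) (inj₁ (toℕ-fromℕ L , refl))

  interior-triangle : ∀ {x} → Interior x → first ⟶ x × x ⟶ last
  interior-triangle {x} (x≢first , x≢last) =
      dec-true (arc? first x) (inj₂ (0<x , λ { (x≡L , _) → x≢L x≡L }))
    , dec-true (arc? x last) (inj₂ (x<last , λ { (_ , x≡0) → x≢0 x≡0 }))
    where
    x≢0 : toℕ x ≢ 0
    x≢0 x≡0 = x≢first (toℕ-injective x≡0)
    x≢L : toℕ x ≢ L
    x≢L x≡L = x≢last (toℕ-injective (trans x≡L (sym (toℕ-fromℕ L))))
    0<x : 0 < toℕ x
    0<x = ℕ.n≢0⇒n>0 x≢0
    x<last : toℕ x < toℕ last
    x<last = subst (toℕ x <_) (sym (toℕ-fromℕ L)) (ℕ.≤∧≢⇒< (ℕ.≤-pred (toℕ<n x)) x≢L)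

  reversed-ends : ∀ {u v} → Reversed u v → u ≡ last × v ≡ first
  reversed-ends (≡L , ≡0) = toℕ-injective (trans ≡L (sym (toℕ-fromℕ L))) , toℕ-injective ≡0

  -- Forward arcs increase toℕ, so every triangle uses the reversed arc.
  triangle-reversed : ∀ {a b c} → a ⟶ b → b ⟶ c → c ⟶ a →
    Reversed a b ⊎ Reversed b c ⊎ Reversed c a
  triangle-reversed {a} {b} {c} ab bc ca
    with does-true (arc? a b) ab | does-true (arc? b c) bc | does-true (arc? c a) ca
  ... | inj₁ rev | _ | _ = inj₁ rev
  ... | inj₂ _ | inj₁ rev | _ = inj₂ (inj₁ rev)
  ... | inj₂ _ | inj₂ _ | inj₁ rev = inj₂ (inj₂ rev)
  ... | inj₂ (a<b , _) | inj₂ (b<c , _) | inj₂ (c<a , _) = ⊥-elim (ℕ.<-asym (ℕ.<-trans a<b b<c) c<a)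

  triangle-shape : ∀ {F} → AvoidedTriangle F → ∃[ z ] Interior z × Triangle F last first z
  triangle-shape {F} (a , b , c , t@(_ , _ , _ , ab , bc , ca)) = z , interior z-tri , z-tri
    where
    normalised : ∃[ z ] Triangle F last first z
    normalised with triangle-reversed ab bc ca
    ... | inj₁ rev with refl , refl ← reversed-ends {a} {b} rev = c , t
    ... | inj₂ (inj₁ rev) with refl , refl ← reversed-ends {b} {c} rev = a , rotate t
    ... | inj₂ (inj₂ rev) with refl , refl ← reversed-ends {c} {a} rev = b , rotate (rotate t)
    z = proj₁ normalised
    z-tri = proj₂ normalised
    interior : ∀ {F z} → Triangle F last first z → Interior z
    interior (_ , _ , _ , _ , first⟶z , z⟶last) =
      (λ z≡first → ⟶-irreflexive first⟶z (sym z≡first)) , ⟶-irreflexive z⟶last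

  Middle : Subset N
  Middle = allBut first last

  Middle⇒interior : ∀ {x} → x ∈ Middle → Interior x
  Middle⇒interior x∈ = (λ { refl → allBut-∌ˡ first last x∈ }) , (λ { refl → allBut-∌ʳ first last x∈ })

  hitting⇒FVS : ∀ {G} → first ∈ G ⊎ last ∈ G ⊎ Middle ⊆ G → FVS T G
  hitting⇒FVS {G} hits = no-triangle⇒FVS λ t → miss (triangle-shape t)
    where
    miss : ∃[ z ] Interior z × Triangle G last first z → Empty
    miss (z , z-interior , last∉ , first∉ , z∉ , _) = avoided hits
      where
      avoided : first ∈ G ⊎ last ∈ G ⊎ Middle ⊆ G → Empty
      avoided (inj₁ first∈) = first∉ first∈
      avoided (inj₂ (inj₁ last∈)) = last∉ last∈
      avoided (inj₂ (inj₂ Middle⊆G)) with ∉allBut (λ z∈ → z∉ (Middle⊆G z∈))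
      ... | inj₁ z≡first = proj₁ z-interior z≡first
      ... | inj₂ z≡last = proj₂ z-interior z≡last

  missing⇒not-FVS : ∀ {G x} → first ∉ G → last ∉ G → Interior x → x ∉ G → ¬ FVS T G
  missing⇒not-FVS first∉ last∉ x-interior x∉ fvs with interior-triangle x-interior
  ... | first⟶x , x⟶last =
    fvs first (triangle⇒cycle (first∉ , x∉ , last∉ , first⟶x , x⟶last , last⟶first))

  -- The empty set is not an FVS; this gives minimality of the two singletons.
  singleton-minimal : ∀ {x} G → G ⊂ ⁅ x ⁆ → ¬ FVS T G
  singleton-minimal G G⊂ =
    missing⇒not-FVS (empty first) (empty last) one-interior (empty one)
    where
    empty = ⊂⁅⁆⇒empty G⊂

  Middle-minimal : ∀ G → G ⊂ Middle → ¬ FVS T G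
  Middle-minimal G (G⊆ , x , x∈ , x∉G) =
    missing⇒not-FVS (λ p → allBut-∌ˡ first last (G⊆ p)) (λ p → allBut-∌ʳ first last (G⊆ p))
      (Middle⇒interior x∈) x∉G

  minimal-first : MinFVS T ⁅ first ⁆
  minimal-first = hitting⇒FVS (inj₁ (x∈⁅x⁆ first)) , singleton-minimal {first}

  minimal-last : MinFVS T ⁅ last ⁆
  minimal-last = hitting⇒FVS (inj₂ (inj₁ (x∈⁅x⁆ last))) , singleton-minimal {last}

  minimal-Middle : MinFVS T Middle
  minimal-Middle = hitting⇒FVS (inj₂ (inj₂ (λ x∈ → x∈))) , Middle-minimal

  ⁅⁆⊆ : ∀ {x} {F : Subset N} → x ∈ F → ⁅ x ⁆ ⊆ F
  ⁅⁆⊆ {x} x∈F y∈ = subst (_∈ _) (sym (x∈⁅y⁆⇒x≡y x y∈)) x∈F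

  -- Every minimal FVS contains one of the three, hence equals it.
  classification : ∀ F → MinFVS T F → F ≡ ⁅ first ⁆ ⊎ F ≡ ⁅ last ⁆ ⊎ F ≡ Middle
  classification F minF with first ∈? F | last ∈? F
  ... | yes first∈ | _ = inj₁ (minimal-⊇-FVS minF (⁅⁆⊆ first∈) (proj₁ minimal-first))
  ... | no _ | yes last∈ = inj₂ (inj₁ (minimal-⊇-FVS minF (⁅⁆⊆ last∈) (proj₁ minimal-last)))
  ... | no first∉ | no last∉ = inj₂ (inj₂ (minimal-⊇-FVS minF Middle⊆F (proj₁ minimal-Middle)))
    where
    Middle⊆F : Middle ⊆ F
    Middle⊆F {x} x∈ with x ∈? F
    ... | yes x∈F = x∈F
    ... | no x∉F = ⊥-elim (missing⇒not-FVS first∉ last∉ (Middle⇒interior x∈) x∉F (proj₁ minF))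

  exactly-three : Exactly3MinFVS T
  exactly-three =
    ⁅ first ⁆ , ⁅ last ⁆ , Middle , minimal-first , minimal-last , minimal-Middle ,
    (λ e → last≢first (sym (x∈⁅y⁆⇒x≡y last (subst (first ∈_) e (x∈⁅x⁆ first))))) ,
    (λ e → allBut-∌ˡ first last (subst (first ∈_) e (x∈⁅x⁆ first))) ,
    (λ e → allBut-∌ʳ first last (subst (last ∈_) e (x∈⁅x⁆ last))) ,
    classification

  -- Every vertex reaches last (first via one), and last reaches every vertex via first.
  reaches-last : ∀ u → Reach T u last
  reaches-last u with u Fin.≟ first | u Fin.≟ last
  ... | yes refl | _ = there {w = one} first⟶one (there one⟶last here)
    where
    first⟶one : first ⟶ one
    first⟶one = proj₁ (interior-triangle one-interior)
    one⟶last : one ⟶ last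
    one⟶last = proj₂ (interior-triangle one-interior)
  ... | no _ | yes refl = here
  ... | no u≢first | no u≢last = there (proj₂ (interior-triangle (u≢first , u≢last))) here

  last-reaches : ∀ v → Reach T last v
  last-reaches v with v Fin.≟ first | v Fin.≟ last
  ... | yes refl | _ = there {w = first} last⟶first here
  ... | no _ | yes refl = here
  ... | no v≢first | no v≢last =
    there {w = first} last⟶first (there {w = v} (proj₁ (interior-triangle (v≢first , v≢last))) here)

  strong : Strong T
  strong u v = reach-trans (reaches-last u) (last-reaches v)

lemma1 : ∀ (n : ℕ) → 3 ≤ n →
    ((T : Tournament n) → Strong T → AtLeast3MinFVS T)
    × (Σ (Tournament n) (λ T → Strong T × Exactly3MinFVS T))
lemma1 (suc (suc (suc m))) (s≤s (s≤s (s≤s z≤n))) =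
    (λ T strong → TournamentTheory.strong⇒three-minimal T strong Fin.zero (Fin.suc Fin.zero) λ ())
  , (Example.T m , Example.strong m , Example.exactly-three m)
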